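{- $\mathsf{TC}_1$ proves: (i) if $a$ is an atom then $a\not\preceq\varnothing$; (ii) if $a,b$ are atoms then $b\preceq a$ iff $a=b$; (iii) if $b$ is an atom then for all $x,y$, $b\preceq x*y$ iff ($b\preceq x$ or $b\preceq y$).
   Context: $\mathsf{TC}_1$ is the theory in the language with a constant $\varnothing$ and binary function $*$, axiomatised by: $\varnothing*x=x\wedge x*\varnothing=x$; $x*y=\varnothing\to(x=\varnothing\wedge y=\varnothing)$; $(x*y)*z=x*(y*z)$; and $x*y=u*v\to\exists w\,((x*w=u\wedge y=w*v)\vee(x=u*w\wedge w*y=v))$. An atom is an $a\neq\varnothing$ such that for all $x,y$, if $x*y=a$ then $x=\varnothing$ or $y=\varnothing$. $x\preceq y$ means $\exists u\,\exists v\,y=(u*x)*v$. -}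

module Defs where

open import Level using (Level; suc)
open import Data.Product using (Σ; ∃; _×_; _,_)
open import Data.Sum using (_⊎_)
open import Relation.Binary.PropositionalEquality using (_≡_)
open import Relation.Nullary using (¬_)

record TC₁-Model (ℓ : Level) : Set (suc ℓ) where
  infixl 7 _*_
  field
    Carrier : Set ℓ
    ∅       : Carrier
    _*_     : Carrier → Carrier → Carrier
    ax-idˡ  : ∀ x → ∅ * x ≡ x
    ax-idʳ  : ∀ x → x * ∅ ≡ x
    ax-nil  : ∀ x y → x * y ≡ ∅ → (x ≡ ∅ × y ≡ ∅)
    ax-assoc : ∀ x y z → (x * y) * z ≡ x * (y * z)
    ax-edit : ∀ x y u v → x * y ≡ u * v →
              ∃ λ w → ((x * w ≡ u × y ≡ w * v) ⊎ (x ≡ u * w × w * y ≡ v))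

  IsAtom : Carrier → Set ℓ
  IsAtom a = ¬ (a ≡ ∅) × (∀ x y → x * y ≡ a → (x ≡ ∅ ⊎ y ≡ ∅))

  infix 4 _⪯_
  _⪯_ : Carrier → Carrier → Set ℓ
  x ⪯ y = ∃ λ u → ∃ λ v → y ≡ (u * x) * v

{-# OPTIONS --safe #-}

-- The editor axiom cuts an occurrence (u * b) * v of b in x * y at the boundary
-- between x and y.  Either the cut misses b, which then lies inside x or inside y,
-- or it falls inside b; since an atom has only trivial factorisations, the cut is
-- then at one end of b and b is again a factor of x or of y.
module Submission where

open import Defs
open import Data.Product using (_×_; _,_; proj₂)
open import Data.Sum using (_⊎_; inj₁; inj₂)
open import Relation.Binary.PropositionalEquality using (_≡_; refl; sym; trans; cong; subst)
open import Relation.Nullary using (¬_; contradiction)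
open import Function.Bundles using (_⇔_; mk⇔)

module Atoms {ℓ} (M : TC₁-Model ℓ) where
  open TC₁-Model M

  private variable
    a b u w x y : Carrier

  ⪯-refl : ∀ x → x ⪯ x
  ⪯-refl x = ∅ , ∅ , sym (trans (ax-idʳ (∅ * x)) (ax-idˡ x))

  ⪯-*⁺ˡ : b ⪯ x → ∀ y → b ⪯ x * y
  ⪯-*⁺ˡ {b} (u , v , refl) y = u , v * y , ax-assoc (u * b) v y

  ⪯-*⁺ʳ : ∀ x → b ⪯ y → b ⪯ x * y
  ⪯-*⁺ʳ {b} x (u , v , refl) = x * u , v ,
    trans (sym (ax-assoc x (u * b) v)) (cong (_* v) (sym (ax-assoc x u b)))

  x≢∅⇒x⋠∅ : ¬ x ≡ ∅ → ¬ x ⪯ ∅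
  x≢∅⇒x⋠∅ {x} x≢∅ (u , v , ∅≡uxv) with ax-nil (u * x) v (sym ∅≡uxv)
  ... | ux≡∅ , _ with ax-nil u x ux≡∅
  ...   | _ , x≡∅ = x≢∅ x≡∅

  atom-factors : IsAtom a → x * y ≡ a → (x ≡ ∅ × y ≡ a) ⊎ (x ≡ a × y ≡ ∅)
  atom-factors {x = x} {y} (_ , atomic) xy≡a with atomic x y xy≡a
  ... | inj₁ refl = inj₁ (refl , trans (sym (ax-idˡ y)) xy≡a)
  ... | inj₂ refl = inj₂ (trans (sym (ax-idʳ x)) xy≡a , refl)

  ⪯-atom⇒≡ : IsAtom a → ¬ b ≡ ∅ → b ⪯ a → b ≡ a
  ⪯-atom⇒≡ {b = b} atom-a b≢∅ (u , v , a≡ubv) with atom-factors atom-a (sym a≡ubv)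
  ... | inj₁ (ub≡∅ , _) = contradiction (proj₂ (ax-nil u b ub≡∅)) b≢∅
  ... | inj₂ (ub≡a , _) with atom-factors atom-a ub≡a
  ...   | inj₁ (_ , b≡a) = b≡a
  ...   | inj₂ (_ , b≡∅) = contradiction b≡∅ b≢∅

  atom-⪯-suffix⁻ : IsAtom b → x * w ≡ u * b → b ⪯ x ⊎ b ⪯ w
  atom-⪯-suffix⁻ {b} {x} {w} {u} atom-b xw≡ub with ax-edit x w u b xw≡ub
  ... | w′ , inj₁ (_ , w≡w′b) = inj₂ (subst (b ⪯_) (sym w≡w′b) (⪯-*⁺ʳ w′ (⪯-refl b)))
  ... | w′ , inj₂ (x≡uw′ , w′w≡b) with atom-factors atom-b w′w≡b
  ...   | inj₁ (_ , w≡b) = inj₂ (subst (b ⪯_) (sym w≡b) (⪯-refl b))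
  ...   | inj₂ (w′≡b , _) =
    inj₁ (subst (b ⪯_) (sym (trans x≡uw′ (cong (u *_) w′≡b))) (⪯-*⁺ʳ u (⪯-refl b)))

  atom-⪯-*⁻ : IsAtom b → b ⪯ x * y → b ⪯ x ⊎ b ⪯ y
  atom-⪯-*⁻ {b} {x} {y} atom-b (u , v , xy≡ubv) with ax-edit x y (u * b) v xy≡ubv
  ... | w , inj₂ (x≡ubw , _) = inj₁ (u , w , x≡ubw)
  ... | w , inj₁ (xw≡ub , y≡wv) with atom-⪯-suffix⁻ atom-b xw≡ub
  ...   | inj₁ b⪯x = inj₁ b⪯x
  ...   | inj₂ b⪯w = inj₂ (subst (b ⪯_) (sym y≡wv) (⪯-*⁺ˡ b⪯w v))

mainTheorem17 : ∀ {ℓ} (M : TC₁-Model ℓ) → let open TC₁-Model M in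
    (∀ a → IsAtom a → ¬ (a ⪯ ∅))
    × (∀ a b → IsAtom a → IsAtom b → (b ⪯ a ⇔ a ≡ b))
    × (∀ b → IsAtom b → ∀ x y → (b ⪯ x * y ⇔ (b ⪯ x ⊎ b ⪯ y)))
mainTheorem17 M =
    (λ a (a≢∅ , _) → x≢∅⇒x⋠∅ a≢∅)
  , (λ a b atom-a (b≢∅ , _) →
       mk⇔ (λ b⪯a → sym (⪯-atom⇒≡ atom-a b≢∅ b⪯a)) (λ { refl → ⪯-refl a }))
  , (λ b atom-b x y →
       mk⇔ (atom-⪯-*⁻ atom-b) λ { (inj₁ b⪯x) → ⪯-*⁺ˡ b⪯x y ; (inj₂ b⪯y) → ⪯-*⁺ʳ x b⪯y })
  where open Atoms M
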